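{- For $n\geq 0$, $$F_{n+2}^I(x,y,q)=x^{n+2}q^{\binom{n+2}{2}}+\sum_{j=0}^{n}x^{n-j}y\,q^{\frac{n^2+3n-j^2+j}{2}}F_j^I(x,y,q).$$
   Context: $S_n(123,132,213)$ is the set of permutations of $[n]$ with no subsequence order isomorphic to $123$, $132$ or $213$; each such $\pi$ is a concatenation of increasing blocks of size $1$ or $2$, each block larger than all later blocks. $s(\pi)$, $d(\pi)$ are the numbers of maximal increasing runs of $\pi$ of length $1$ and $2$, and $inv(\pi)$ is the number of inversions. $F_n^I(x,y,q)=\sum_{\pi\in S_n(123,132,213)}x^{s(\pi)}y^{d(\pi)}q^{inv(\pi)}$ (so $F_0^I=1$). -}

module Defs where

open import Level using (Level)
open import Data.Nat using (ℕ; zero; suc; _<ᵇ_; _≡ᵇ_)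
open import Data.Bool using (Bool; true; false; if_then_else_; not; _∧_; _∨_)
open import Data.List using (List; []; _∷_; map; _++_; length; filterᵇ; concatMap; upTo; foldr)
open import Data.Bool.ListAction using (and)
open import Data.Product using (_×_; _,_)
open import Algebra.Bundles using (CommutativeSemiring)

allᵇ : {A : Set} → (A → Bool) → List A → Bool
allᵇ p xs = and (map p xs)

pairs : List ℕ → List (ℕ × ℕ)
pairs []       = []
pairs (a ∷ xs) = map (λ b → a , b) xs ++ pairs xs

triples : List ℕ → List (ℕ × ℕ × ℕ)
triples []       = []
triples (a ∷ xs) = map (λ { (b , c) → a , b , c }) (pairs xs) ++ triples xs

is123 is132 is213 : ℕ × ℕ × ℕ → Bool
is123 (a , b , c) = (a <ᵇ b) ∧ (b <ᵇ c)
is132 (a , b , c) = (a <ᵇ c) ∧ (c <ᵇ b)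
is213 (a , b , c) = (b <ᵇ a) ∧ (a <ᵇ c)

avoids : List ℕ → Bool
avoids π = allᵇ (λ t → not (is123 t ∨ is132 t ∨ is213 t)) (triples π)

words : ℕ → ℕ → List (List ℕ)
words n zero    = [] ∷ []
words n (suc k) = concatMap (λ a → map (a ∷_) (words n k)) (map suc (upTo n))

distinct : List ℕ → Bool
distinct π = allᵇ (λ { (a , b) → not (a ≡ᵇ b) }) (pairs π)

Perms : ℕ → List (List ℕ)
Perms n = filterᵇ distinct (words n n)

Av : ℕ → List (List ℕ)
Av n = filterᵇ avoids (Perms n)

inv : List ℕ → ℕ
inv π = length (filterᵇ (λ { (a , b) → b <ᵇ a }) (pairs π))

-- lengths of the maximal increasing runs, left to right
runsFrom : ℕ → ℕ → List ℕ → List ℕ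
runsFrom prev len []       = len ∷ []
runsFrom prev len (b ∷ xs) =
  if prev <ᵇ b then runsFrom b (suc len) xs else len ∷ runsFrom b 1 xs

runs : List ℕ → List ℕ
runs []       = []
runs (a ∷ xs) = runsFrom a 1 xs

sStat dStat : List ℕ → ℕ
sStat π = length (filterᵇ (λ l → l ≡ᵇ 1) (runs π))
dStat π = length (filterᵇ (λ l → l ≡ᵇ 2) (runs π))

module _ {c ℓ : Level} (R : CommutativeSemiring c ℓ) where
  open CommutativeSemiring R

  pow : Carrier → ℕ → Carrier
  pow x zero    = 1#
  pow x (suc n) = x * pow x n

  sumTo : ℕ → (ℕ → Carrier) → Carrier
  sumTo zero    f = f 0
  sumTo (suc n) f = sumTo n f + f (suc n)

  FI : Carrier → Carrier → Carrier → ℕ → Carrier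
  FI x y q n = foldr (λ π acc → (pow x (sStat π) * pow y (dStat π)) * pow q (inv π) + acc) 0# (Av n)

-- A permutation in S_{n+2}(123,132,213) starts with n+2 or with n+1 n+2: if its first
-- letter a is at most n, then n+1 and n+2 both occur later and form 123 or 132 with a,
-- and if it starts with n+1, then n+2 occurs later and any letter b ≤ n in between gives
-- 213. Conversely, prepending n+2 to a member of S_{n+1}(123,132,213), or n+1 n+2 to a
-- member of S_n(123,132,213), creates no forbidden pattern. The first adds a run of
-- length 1 and n+1 inversions, the second a run of length 2 and 2n inversions, so
--   F_{n+2} = x q^{n+1} F_{n+1} + y q^{2n} F_n.
-- Unrolling this recurrence down to F_1 = x gives the closed form, because the exponents
-- telescope: (n+2) + C(n+2,2) = C(n+3,2) and (n+2) + e(n,j) = e(n+1,j) for j ≤ n, where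
-- e(n,j) = (n² + 3n + j - j²)/2, while the new term y q^{2(n+1)} F_{n+1} is the j = n+1 summand.

module Submission where

open import Defs
open import Level using (Level)
open import Algebra.Bundles using (CommutativeSemiring)
open import Data.Bool using (Bool; true; false; not; _∧_; _∨_; T)
open import Data.Bool.Properties using (T-≡; T-∧; ∧-assoc)
open import Data.Empty using (⊥; ⊥-elim)
open import Data.List using (List; []; _∷_; [_]; map; _++_; length; filterᵇ; concatMap; upTo; foldr)
open import Data.List.Properties
  using (concatMap-cong; concatMap-++; map-++; map-∘; ++-assoc; ++-identityʳ; upTo-∷ʳ; length-++; length-map; length-upTo; length-removeAt′; filter-++; filter-all; filter-none; filter-reject)
open import Data.List.Membership.Propositional using (_∈_; _∉_)
open import Data.List.Membership.Propositional.Properties using (∈-map⁺; ∈-map⁻; ∈-++⁺ˡ; ∈-++⁺ʳ; ∈-upTo⁺; ∈-upTo⁻)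
open import Data.List.Relation.Binary.Subset.Propositional using (_⊆_)
open import Data.List.Relation.Unary.All as All using (All; []; _∷_)
import Data.List.Relation.Unary.All.Properties as All
open import Data.List.Relation.Unary.Any using (here; there; _─_; any?)
open import Data.List.Relation.Unary.AllPairs using ([]; _∷_)
open import Data.List.Relation.Unary.Unique.Propositional using (Unique)
open import Data.Nat as N using (ℕ; zero; suc; _<_; _≤_; _<ᵇ_; _≡ᵇ_; z≤n; s≤s; _≟_)
open import Data.Nat.Properties
  using (<⇒<ᵇ; <ᵇ⇒<; ≡ᵇ⇒≡; ≡⇒≡ᵇ; <⇒≤; <⇒≢; >⇒≢; <⇒≯; <⇒≱; <-irrefl; <-trans; <-≤-trans; ≤-refl; ≤-reflexive; ≤-trans; n<1+n; n≤1+n; m<n⇒m<1+n; m≤n⇒m≤1+n; *-mono-≤; m≤m+n; m+n∸m≡n; +-∸-comm; +-∸-assoc; n∸n≡0; module ≤-Reasoning)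
import Data.Nat.Properties as ℕ
open import Data.Nat.Combinatorics using (_C_; nCk+nC[k+1]≡[n+1]C[k+1]; nC1≡n)
open import Data.Nat.DivMod using (+-distrib-/-∣ʳ; m*n/n≡m)
open import Data.Nat.Divisibility using (divides)
open import Data.Nat.Tactic.RingSolver using (solve-∀)
open import Data.Product using (_×_; _,_; proj₁; proj₂)
open import Data.Sum using (_⊎_; inj₁; inj₂)
open import Data.Unit using (tt)
open import Function using (_∘_; Equivalence)
open import Relation.Binary.Definitions using (DecidableEquality)
open import Relation.Binary.PropositionalEquality as ≡ using (_≡_; _≢_; refl; sym; trans; cong; cong₂; subst; module ≡-Reasoning)
open import Relation.Nullary using (¬_; yes; no)
open import Relation.Nullary.Decidable using (T?)

private variable
  A B : Set

allᵇ-++ : (p : A → Bool) (xs ys : List A) → allᵇ p (xs ++ ys) ≡ allᵇ p xs ∧ allᵇ p ys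
allᵇ-++ p []       ys = refl
allᵇ-++ p (x ∷ xs) ys = trans (cong (p x ∧_) (allᵇ-++ p xs ys)) (sym (∧-assoc (p x) _ _))

allᵇ-++-true : (p : A → Bool) (xs ys : List A) → All (T ∘ p) xs → allᵇ p (xs ++ ys) ≡ allᵇ p ys
allᵇ-++-true p xs ys pxs =
  trans (allᵇ-++ p xs ys) (cong (_∧ allᵇ p ys) (Equivalence.to T-≡ (All.all⁻ p pxs)))

filterᵇ-∧ : (p q : A → Bool) (xs : List A) → filterᵇ p (filterᵇ q xs) ≡ filterᵇ (λ x → q x ∧ p x) xs
filterᵇ-∧ p q []       = refl
filterᵇ-∧ p q (x ∷ xs) with q x
... | false = filterᵇ-∧ p q xs
... | true with p x
...   | true  = cong (x ∷_) (filterᵇ-∧ p q xs)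
...   | false = filterᵇ-∧ p q xs

filterᵇ-cong : (p q : A → Bool) (xs : List A) → All (λ x → p x ≡ q x) xs → filterᵇ p xs ≡ filterᵇ q xs
filterᵇ-cong p q []       []         = refl
filterᵇ-cong p q (x ∷ xs) (_ ∷ h) with p x | q x
filterᵇ-cong p q (x ∷ xs) (refl ∷ h) | true  | true  = cong (x ∷_) (filterᵇ-cong p q xs h)
filterᵇ-cong p q (x ∷ xs) (refl ∷ h) | false | false = filterᵇ-cong p q xs h

filterᵇ-map : (p : B → Bool) (f : A → B) (xs : List A) → filterᵇ p (map f xs) ≡ map f (filterᵇ (p ∘ f) xs)
filterᵇ-map p f []       = refl
filterᵇ-map p f (x ∷ xs) with p (f x)
... | true  = cong (f x ∷_) (filterᵇ-map p f xs)
... | false = filterᵇ-map p f xs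

filterᵇ-concatMap : (p : B → Bool) (f : A → List B) (xs : List A) →
  filterᵇ p (concatMap f xs) ≡ concatMap (filterᵇ p ∘ f) xs
filterᵇ-concatMap p f []       = refl
filterᵇ-concatMap p f (x ∷ xs) =
  trans (filter-++ (T? ∘ p) (f x) (concatMap f xs)) (cong (filterᵇ p (f x) ++_) (filterᵇ-concatMap p f xs))

concatMap-[] : (f : A → List B) (xs : List A) → All (λ x → f x ≡ []) xs → concatMap f xs ≡ []
concatMap-[] f []       []           = refl
concatMap-[] f (x ∷ xs) (fx≡[] ∷ h) rewrite fx≡[] = concatMap-[] f xs h

¬T⇒T-not : ∀ {b} → ¬ T b → T (not b)
¬T⇒T-not {false} _   = _
¬T⇒T-not {true}  ¬T = ¬T _

T-not⇒¬T : ∀ {b} → T (not b) → ¬ T b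
T-not⇒¬T {false} _ ()

-- Pigeonhole principle for duplicate-free lists

∈-∷⁻ : ∀ {a c : A} {w} → a ≢ c → c ∈ a ∷ w → c ∈ w
∈-∷⁻ a≢c (here refl)  = ⊥-elim (a≢c refl)
∈-∷⁻ _   (there c∈w) = c∈w

∈-─ : ∀ {x z} {ys : List A} (x∈ys : x ∈ ys) → z ∈ ys → x ≢ z → z ∈ (ys ─ x∈ys)
∈-─ (here refl) (here refl)  x≢z = ⊥-elim (x≢z refl)
∈-─ (here refl) (there z∈ys) _   = z∈ys
∈-─ (there x∈ys) (here refl) _   = here refl
∈-─ (there x∈ys) (there z∈ys) x≢z = there (∈-─ x∈ys z∈ys x≢z)

Unique-⊆⇒length≤ : ∀ {xs ys : List A} → Unique xs → xs ⊆ ys → length xs ≤ length ys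
Unique-⊆⇒length≤ {xs = []}     _          _     = z≤n
Unique-⊆⇒length≤ {xs = x ∷ xs} {ys} (x∉xs ∷ u) xs⊆ys =
  subst (suc (length xs) ≤_) (sym (length-removeAt′ ys _))
    (s≤s (Unique-⊆⇒length≤ u λ z∈xs → ∈-─ x∈ys (xs⊆ys (there z∈xs)) (All.lookup x∉xs z∈xs)))
  where x∈ys = xs⊆ys (here refl)

Unique-⊆⇒⊇ : DecidableEquality A → ∀ {xs ys : List A} → Unique xs → xs ⊆ ys →
  length ys ≤ length xs → ys ⊆ xs
Unique-⊆⇒⊇ _≟_ {xs} {ys} u xs⊆ys |ys|≤|xs| {z} z∈ys with any? (z ≟_) xs
... | yes z∈xs = z∈xs
... | no  z∉xs = ⊥-elim (<-irrefl refl (begin-strict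
      length xs               ≤⟨ Unique-⊆⇒length≤ u xs⊆ys─z ⟩
      length (ys ─ z∈ys)      <⟨ ≤-refl ⟩
      suc (length (ys ─ z∈ys)) ≡⟨ length-removeAt′ ys _ ⟨
      length ys               ≤⟨ |ys|≤|xs| ⟩
      length xs               ∎))
  where
  open ≤-Reasoning
  xs⊆ys─z : xs ⊆ (ys ─ z∈ys)
  xs⊆ys─z w∈xs = ∈-─ z∈ys (xs⊆ys w∈xs) λ { refl → z∉xs w∈xs }

<ᵇ-true : ∀ {m n} → m < n → (m <ᵇ n) ≡ true
<ᵇ-true m<n = Equivalence.to T-≡ (<⇒<ᵇ m<n)

<ᵇ-false : ∀ {m n} → n ≤ m → (m <ᵇ n) ≡ false
<ᵇ-false {m} {n} n≤m with m <ᵇ n in eq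
... | false = refl
... | true  = ⊥-elim (<⇒≱ (<ᵇ⇒< m n (Equivalence.from T-≡ eq)) n≤m)

isForbidden : ℕ × ℕ × ℕ → Bool
isForbidden t = is123 t ∨ is132 t ∨ is213 t

forbidden-123 : ∀ {a b c} → a < b → b < c → T (isForbidden (a , b , c))
forbidden-123 a<b b<c rewrite <ᵇ-true a<b | <ᵇ-true b<c = tt

forbidden-132 : ∀ {a b c} → a < c → c < b → T (isForbidden (a , b , c))
forbidden-132 a<c c<b
  rewrite <ᵇ-true (<-trans a<c c<b) | <ᵇ-false (<⇒≤ c<b) | <ᵇ-true a<c | <ᵇ-true c<b = tt

forbidden-213 : ∀ {a b c} → b < a → a < c → T (isForbidden (a , b , c))
forbidden-213 b<a a<c
  rewrite <ᵇ-true b<a | <ᵇ-true a<c | <ᵇ-false (<⇒≤ b<a) | <ᵇ-false (<⇒≤ (<-trans b<a a<c)) = tt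

allowed-3xx : ∀ {a b c} → b < a → c < a → ¬ T (isForbidden (a , b , c))
allowed-3xx b<a c<a rewrite <ᵇ-false (<⇒≤ b<a) | <ᵇ-false (<⇒≤ c<a) | <ᵇ-true b<a = λ ()

allowed-231 : ∀ {a b c} → a < b → c < a → ¬ T (isForbidden (a , b , c))
allowed-231 a<b c<a
  rewrite <ᵇ-true a<b | <ᵇ-false (<⇒≤ c<a) | <ᵇ-false (<⇒≤ a<b) | <ᵇ-false (<⇒≤ (<-trans c<a a<b)) = λ ()

∈-pairs-∷ : ∀ a {b} w → b ∈ w → (a , b) ∈ pairs (a ∷ w)
∈-pairs-∷ a w b∈w = ∈-++⁺ˡ (∈-map⁺ (a ,_) b∈w)

∈-triples-∷ : ∀ a {b c} w → (b , c) ∈ pairs w → (a , b , c) ∈ triples (a ∷ w)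
∈-triples-∷ a w bc∈w = ∈-++⁺ˡ (∈-map⁺ _ bc∈w)

∈-pairs : ∀ {b c} w → b ∈ w → c ∈ w → b ≢ c → (b , c) ∈ pairs w ⊎ (c , b) ∈ pairs w
∈-pairs (d ∷ w) (here refl) (here refl) b≢c = ⊥-elim (b≢c refl)
∈-pairs (d ∷ w) (here refl) (there c∈w) _   = inj₁ (∈-pairs-∷ d w c∈w)
∈-pairs (d ∷ w) (there b∈w) (here refl) _   = inj₂ (∈-pairs-∷ d w b∈w)
∈-pairs (d ∷ w) (there b∈w) (there c∈w) b≢c with ∈-pairs w b∈w c∈w b≢c
... | inj₁ bc∈w = inj₁ (∈-++⁺ʳ _ bc∈w)
... | inj₂ cb∈w = inj₂ (∈-++⁺ʳ _ cb∈w)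

pairs-All : ∀ {P : ℕ → Set} w → All P w → All (λ bc → P (proj₁ bc) × P (proj₂ bc)) (pairs w)
pairs-All []      []         = []
pairs-All (a ∷ w) (pa ∷ pw) = All.++⁺ (All.map⁺ (All.map (pa ,_) pw)) (pairs-All w pw)

distinct⇒Unique : ∀ w → T (distinct w) → Unique w
distinct⇒Unique []      _ = []
distinct⇒Unique (a ∷ w) h with All.++⁻ (map (a ,_) w) (All.all⁺ _ _ h)
... | head , rest = All.map differ (All.map⁻ head) ∷ distinct⇒Unique w (All.all⁻ _ rest)
  where
  differ : ∀ {b} → T (not (a ≡ᵇ b)) → a ≢ b
  differ a≢ᵇb refl = T-not⇒¬T a≢ᵇb (≡⇒≡ᵇ a a refl)

admissible : List ℕ → Bool
admissible w = distinct w ∧ avoids w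

Av≡filter-admissible : ∀ n → Av n ≡ filterᵇ admissible (words n n)
Av≡filter-admissible n = filterᵇ-∧ avoids distinct (words n n)

admissible⇒Unique : ∀ w → T (admissible w) → Unique w
admissible⇒Unique w = distinct⇒Unique w ∘ proj₁ ∘ Equivalence.to T-∧

admissible⇒∉ : ∀ {a} w → T (admissible (a ∷ w)) → a ∉ w
admissible⇒∉ {a} w ok a∈w with admissible⇒Unique (a ∷ w) ok
... | a∉w ∷ _ = All.lookup a∉w a∈w refl

admissible⇒allowed : ∀ {t} w → T (admissible w) → t ∈ triples w → ¬ T (isForbidden t)
admissible⇒allowed w ok t∈w =
  T-not⇒¬T (All.lookup (All.all⁺ _ _ (proj₂ (Equivalence.to T-∧ ok))) t∈w)

admissible-∷ : ∀ a v → All (a ≢_) v → All (λ bc → ¬ T (isForbidden (a , bc))) (pairs v) →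
  admissible (a ∷ v) ≡ admissible v
admissible-∷ a v a∉v allowed = cong₂ _∧_
  (allᵇ-++-true _ (map (a ,_) v) (pairs v) (All.map⁺ (All.map (λ a≢b → ¬T⇒T-not (a≢b ∘ ≡ᵇ⇒≡ a _)) a∉v)))
  (allᵇ-++-true _ (map _ (pairs v)) (triples v) (All.map⁺ (All.map ¬T⇒T-not allowed)))

admissible-max-∷ : ∀ {a} w → All (_< a) w → admissible (a ∷ w) ≡ admissible w
admissible-max-∷ {a} w w<a = admissible-∷ a w (All.map >⇒≢ w<a)
  (All.map (λ (b<a , c<a) → allowed-3xx b<a c<a) (pairs-All w w<a))

admissible-rise-∷ : ∀ {a b} w → a < b → All (_< a) w → admissible (a ∷ b ∷ w) ≡ admissible (b ∷ w)
admissible-rise-∷ {a} {b} w a<b w<a = admissible-∷ a (b ∷ w) (<⇒≢ a<b ∷ All.map >⇒≢ w<a)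
  (All.++⁺ (All.map⁺ (All.map (allowed-231 a<b) w<a))
           (All.map (λ (c<a , d<a) → allowed-3xx c<a d<a) (pairs-All w w<a)))

letters : ℕ → List ℕ
letters N = map suc (upTo N)

letters-suc : ∀ N → letters (suc N) ≡ letters N ++ [ suc N ]
letters-suc N = trans (cong (map suc) (sym (upTo-∷ʳ N))) (map-++ suc (upTo N) [ N ])

letters-suc-suc : ∀ n → letters (suc (suc n)) ≡ letters n ++ suc n ∷ suc (suc n) ∷ []
letters-suc-suc n = begin
  letters (suc (suc n))                      ≡⟨ letters-suc (suc n) ⟩
  letters (suc n) ++ [ suc (suc n) ]         ≡⟨ cong (_++ [ suc (suc n) ]) (letters-suc n) ⟩
  (letters n ++ [ suc n ]) ++ [ suc (suc n) ] ≡⟨ ++-assoc (letters n) [ suc n ] [ suc (suc n) ] ⟩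
  letters n ++ suc n ∷ suc (suc n) ∷ []      ∎
  where open ≡-Reasoning

length-letters : ∀ N → length (letters N) ≡ N
length-letters N = trans (length-map suc (upTo N)) (length-upTo N)

∈-letters⁺ : ∀ {N i} → i < N → suc i ∈ letters N
∈-letters⁺ i<N = ∈-map⁺ suc (∈-upTo⁺ i<N)

∈-letters⁻ : ∀ {N b} → b ∈ letters N → b ≤ N
∈-letters⁻ b∈ with _ , i∈ , refl ← ∈-map⁻ suc b∈ = ∈-upTo⁻ i∈

letters-mono : ∀ {M N b} → M ≤ N → b ∈ letters M → b ∈ letters N
letters-mono M≤N b∈ with _ , i∈ , refl ← ∈-map⁻ suc b∈ = ∈-letters⁺ (<-≤-trans (∈-upTo⁻ i∈) M≤N)

Word : ℕ → ℕ → List ℕ → Set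
Word N k w = length w ≡ k × All (_∈ letters N) w

words-Word : ∀ N k → All (Word N k) (words N k)
words-Word N zero    = (refl , []) ∷ []
words-Word N (suc k) = All.concat⁺ (All.map⁺ (All.tabulate λ a∈ →
  All.map⁺ (All.map (λ (|w|≡k , w⊆) → cong suc |w|≡k , a∈ ∷ w⊆) (words-Word N k))))

Word-<-suc : ∀ {N k w} → Word N k w → All (_< suc N) w
Word-<-suc (_ , w⊆) = All.map (s≤s ∘ ∈-letters⁻) w⊆

Word-Unique⇒⊇ : ∀ {N w} → Word N N w → Unique w → ∀ {c} → c ∈ letters N → c ∈ w
Word-Unique⇒⊇ {N} (|w|≡N , w⊆) u =
  Unique-⊆⇒⊇ _≟_ u (All.lookup w⊆) (≤-reflexive (trans (length-letters N) (sym |w|≡N)))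

filterᵇ-words-suc : ∀ (p : List ℕ → Bool) N k → filterᵇ p (words N (suc k))
  ≡ concatMap (λ a → map (a ∷_) (filterᵇ (p ∘ (a ∷_)) (words N k))) (letters N)
filterᵇ-words-suc p N k = trans (filterᵇ-concatMap p _ (letters N))
  (concatMap-cong (λ a → filterᵇ-map p (a ∷_) (words N k)) (letters N))

filterᵇ-words-without-top : ∀ (p : List ℕ → Bool) N k → (∀ w → suc N ∈ w → ¬ T (p w)) →
  filterᵇ p (words (suc N) k) ≡ filterᵇ p (words N k)
filterᵇ-words-without-top p N zero    _        = refl
filterᵇ-words-without-top p N (suc k) rejected = begin
  filterᵇ p (words (suc N) (suc k))              ≡⟨ filterᵇ-words-suc p (suc N) k ⟩
  concatMap (block (suc N)) (letters (suc N))   ≡⟨ concatMap-cong (cong (map _) ∘ shrink) (letters (suc N)) ⟩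
  concatMap (block N) (letters (suc N))         ≡⟨ cong (concatMap (block N)) (letters-suc N) ⟩
  concatMap (block N) (letters N ++ [ suc N ])  ≡⟨ concatMap-++ (block N) (letters N) [ suc N ] ⟩
  concatMap (block N) (letters N) ++ (block N (suc N) ++ [])
    ≡⟨ cong (λ b → concatMap (block N) (letters N) ++ (map (suc N ∷_) b ++ []))
         (filter-none (T? ∘ (p ∘ (suc N ∷_))) {words N k} (All.universal (λ w → rejected (suc N ∷ w) (here refl)) _)) ⟩
  concatMap (block N) (letters N) ++ []         ≡⟨ ++-identityʳ _ ⟩
  concatMap (block N) (letters N)               ≡⟨ filterᵇ-words-suc p N k ⟨
  filterᵇ p (words N (suc k))                   ∎
  where
  open ≡-Reasoning
  block : ℕ → ℕ → List (List ℕ)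
  block M a = map (a ∷_) (filterᵇ (p ∘ (a ∷_)) (words M k))
  shrink : ∀ a → filterᵇ (p ∘ (a ∷_)) (words (suc N) k) ≡ filterᵇ (p ∘ (a ∷_)) (words N k)
  shrink a = filterᵇ-words-without-top (p ∘ (a ∷_)) N k (λ w sN∈w → rejected (a ∷ w) (there sN∈w))

filterᵇ-words-top-two : ∀ (p : List ℕ → Bool) n k →
  (∀ {a w} → a ∈ letters n → Word (suc (suc n)) k w → ¬ T (p (a ∷ w))) →
  filterᵇ p (words (suc (suc n)) (suc k))
    ≡ map (suc n ∷_) (filterᵇ (p ∘ (suc n ∷_)) (words (suc (suc n)) k))
      ++ map (suc (suc n) ∷_) (filterᵇ (p ∘ (suc (suc n) ∷_)) (words (suc (suc n)) k))
filterᵇ-words-top-two p n k rejected = begin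
  filterᵇ p (words (suc (suc n)) (suc k))
    ≡⟨ filterᵇ-words-suc p (suc (suc n)) k ⟩
  concatMap block (letters (suc (suc n)))
    ≡⟨ cong (concatMap block) (letters-suc-suc n) ⟩
  concatMap block (letters n ++ suc n ∷ suc (suc n) ∷ [])
    ≡⟨ concatMap-++ block (letters n) (suc n ∷ suc (suc n) ∷ []) ⟩
  concatMap block (letters n) ++ block (suc n) ++ block (suc (suc n)) ++ []
    ≡⟨ cong₂ (λ xs ys → xs ++ block (suc n) ++ ys)
         (concatMap-[] block (letters n) (All.tabulate λ a∈ → cong (map _)
           (filter-none (T? ∘ (p ∘ (_ ∷_))) (All.map (rejected a∈) (words-Word _ k)))))
         (++-identityʳ _) ⟩
  block (suc n) ++ block (suc (suc n)) ∎
  where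
  open ≡-Reasoning
  block : ℕ → List (List ℕ)
  block a = map (a ∷_) (filterᵇ (p ∘ (a ∷_)) (words (suc (suc n)) k))

-- Decomposition of S_{n+2}(123,132,213) by its first letters

small-first-¬admissible : ∀ {n a w} → a ∈ letters n → Word (suc (suc n)) (suc n) w →
  ¬ T (admissible (a ∷ w))
small-first-¬admissible {n} {a} {w} a∈ (|w|≡ , w⊆) ok =
  forbidden (∈-pairs w (in-tail (∈-letters⁺ (m<n⇒m<1+n (n<1+n n))) a<n+1)
                       (in-tail (∈-letters⁺ n+1<n+2) (m<n⇒m<1+n a<n+1))
                       (<⇒≢ n+1<n+2))
  where
  a<n+1 = s≤s (∈-letters⁻ a∈)
  n+1<n+2 = n<1+n (suc n)
  in-tail : ∀ {c} → c ∈ letters (suc (suc n)) → a < c → c ∈ w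
  in-tail c∈ a<c = ∈-∷⁻ (<⇒≢ a<c)
    (Word-Unique⇒⊇ (cong suc |w|≡ , letters-mono (m≤n⇒m≤1+n (n≤1+n n)) a∈ ∷ w⊆)
                   (admissible⇒Unique (a ∷ w) ok) c∈)
  forbidden : (suc n , suc (suc n)) ∈ pairs w ⊎ (suc (suc n) , suc n) ∈ pairs w → ⊥
  forbidden (inj₁ 12∈w) =
    admissible⇒allowed (a ∷ w) ok (∈-triples-∷ a w 12∈w) (forbidden-123 a<n+1 n+1<n+2)
  forbidden (inj₂ 21∈w) =
    admissible⇒allowed (a ∷ w) ok (∈-triples-∷ a w 21∈w) (forbidden-132 a<n+1 n+1<n+2)

small-second-¬admissible : ∀ {n b w} → b ∈ letters n → Word (suc (suc n)) n w →
  ¬ T (admissible (suc n ∷ b ∷ w))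
small-second-¬admissible {n} {b} {w} b∈ (|w|≡ , w⊆) ok =
  admissible⇒allowed (suc n ∷ b ∷ w) ok (∈-triples-∷ (suc n) (b ∷ w) (∈-pairs-∷ b w n+2∈w))
    (forbidden-213 b<n+1 n+1<n+2)
  where
  b<n+1 = s≤s (∈-letters⁻ b∈)
  n+1<n+2 = n<1+n (suc n)
  n+2∈w : suc (suc n) ∈ w
  n+2∈w = ∈-∷⁻ (<⇒≢ (m<n⇒m<1+n b<n+1)) (∈-∷⁻ (<⇒≢ n+1<n+2)
    (Word-Unique⇒⊇ (cong (suc ∘ suc) |w|≡ , ∈-letters⁺ (m<n⇒m<1+n (n<1+n n))
                                             ∷ letters-mono (m≤n⇒m≤1+n (n≤1+n n)) b∈ ∷ w⊆)
                   (admissible⇒Unique (suc n ∷ b ∷ w) ok) (∈-letters⁺ n+1<n+2)))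

filterᵇ-admissible-top-∷ : ∀ N k →
  filterᵇ (admissible ∘ (suc N ∷_)) (words (suc N) k) ≡ filterᵇ admissible (words N k)
filterᵇ-admissible-top-∷ N k = trans
  (filterᵇ-words-without-top _ N k λ w N+1∈w ok → admissible⇒∉ w ok N+1∈w)
  (filterᵇ-cong _ _ (words N k)
    (All.map (λ {w} w∈ → admissible-max-∷ w (Word-<-suc w∈)) (words-Word N k)))

filterᵇ-admissible-rise-∷ : ∀ n k →
  filterᵇ (λ w → admissible (suc n ∷ suc (suc n) ∷ w)) (words (suc (suc n)) k)
    ≡ filterᵇ admissible (words n k)
filterᵇ-admissible-rise-∷ n k = begin
  filterᵇ p (words (suc (suc n)) k)
    ≡⟨ filterᵇ-words-without-top p (suc n) k n+2-repeated ⟩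
  filterᵇ p (words (suc n) k)
    ≡⟨ filterᵇ-words-without-top p n k (λ w n+1∈w ok → admissible⇒∉ (suc (suc n) ∷ w) ok (there n+1∈w)) ⟩
  filterᵇ p (words n k)
    ≡⟨ filterᵇ-cong p admissible (words n k) (All.map (λ {w} w∈ → let w<n+1 = Word-<-suc w∈ in
         trans (admissible-rise-∷ w (n<1+n (suc n)) w<n+1)
               (admissible-max-∷ w (All.map m<n⇒m<1+n w<n+1))) (words-Word n k)) ⟩
  filterᵇ admissible (words n k) ∎
  where
  open ≡-Reasoning
  p : List ℕ → Bool
  p w = admissible (suc n ∷ suc (suc n) ∷ w)
  n+2-repeated : ∀ w → suc (suc n) ∈ w → ¬ T (p w)
  n+2-repeated w n+2∈w ok with admissible⇒Unique (suc n ∷ suc (suc n) ∷ w) ok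
  ... | _ ∷ n+2∉w ∷ _ = All.lookup n+2∉w n+2∈w refl

Av-suc-suc : ∀ n → Av (suc (suc n))
  ≡ map (λ σ → suc n ∷ suc (suc n) ∷ σ) (Av n) ++ map (suc (suc n) ∷_) (Av (suc n))
Av-suc-suc n = begin
  Av (suc (suc n))
    ≡⟨ Av≡filter-admissible (suc (suc n)) ⟩
  filterᵇ admissible (words (suc (suc n)) (suc (suc n)))
    ≡⟨ filterᵇ-words-top-two admissible n (suc n) small-first-¬admissible ⟩
  map (suc n ∷_) (filterᵇ (admissible ∘ (suc n ∷_)) (words (suc (suc n)) (suc n)))
    ++ map (suc (suc n) ∷_) (filterᵇ (admissible ∘ (suc (suc n) ∷_)) (words (suc (suc n)) (suc n)))
    ≡⟨ cong₂ (λ xs ys → map (suc n ∷_) xs ++ map (suc (suc n) ∷_) ys)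
         first-letter-n+1 (filterᵇ-admissible-top-∷ (suc n) (suc n)) ⟩
  map (suc n ∷_) (map (suc (suc n) ∷_) (filterᵇ admissible (words n n)))
    ++ map (suc (suc n) ∷_) (filterᵇ admissible (words (suc n) (suc n)))
    ≡⟨ cong₂ _++_ (trans (sym (map-∘ _)) (cong (map _) (sym (Av≡filter-admissible n))))
                  (cong (map _) (sym (Av≡filter-admissible (suc n)))) ⟩
  map (λ σ → suc n ∷ suc (suc n) ∷ σ) (Av n) ++ map (suc (suc n) ∷_) (Av (suc n)) ∎
  where
  open ≡-Reasoning
  first-letter-n+1 : filterᵇ (admissible ∘ (suc n ∷_)) (words (suc (suc n)) (suc n))
    ≡ map (suc (suc n) ∷_) (filterᵇ admissible (words n n))
  first-letter-n+1 = begin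
    filterᵇ (admissible ∘ (suc n ∷_)) (words (suc (suc n)) (suc n))
      ≡⟨ filterᵇ-words-top-two (admissible ∘ (suc n ∷_)) n n small-second-¬admissible ⟩
    map (suc n ∷_) (filterᵇ (λ w → admissible (suc n ∷ suc n ∷ w)) (words (suc (suc n)) n))
      ++ map (suc (suc n) ∷_) (filterᵇ (λ w → admissible (suc n ∷ suc (suc n) ∷ w)) (words (suc (suc n)) n))
      ≡⟨ cong₂ (λ xs ys → map (suc n ∷_) xs ++ map (suc (suc n) ∷_) ys)
           (filter-none (T? ∘ λ w → admissible (suc n ∷ suc n ∷ w)) {words (suc (suc n)) n}
             (All.universal (λ w ok → admissible⇒∉ (suc n ∷ w) ok (here refl)) _))
           (filterᵇ-admissible-rise-∷ n n) ⟩
    map (suc (suc n) ∷_) (filterᵇ admissible (words n n)) ∎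

Av-Word : ∀ n → All (Word n n) (Av n)
Av-Word n = All.filter⁺ (T? ∘ avoids) (All.filter⁺ (T? ∘ distinct) (words-Word n n))

runsFrom-max : ∀ {a} l σ → All (_< a) σ → runsFrom a l σ ≡ l ∷ runs σ
runsFrom-max l []      _         = refl
runsFrom-max l (b ∷ σ) (b<a ∷ _) rewrite <ᵇ-false (<⇒≤ b<a) = refl

runs-rise-∷ : ∀ {a b} σ → a < b → All (_< a) σ → runs (a ∷ b ∷ σ) ≡ 2 ∷ runs σ
runs-rise-∷ σ a<b σ<a rewrite <ᵇ-true a<b = runsFrom-max 2 σ (All.map (λ c<a → <-trans c<a a<b) σ<a)

length-filterᵇ-pairs-∷ : ∀ (p : ℕ × ℕ → Bool) a σ →
  length (filterᵇ p (pairs (a ∷ σ))) ≡ length (filterᵇ (p ∘ (a ,_)) σ) N.+ length (filterᵇ p (pairs σ))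
length-filterᵇ-pairs-∷ p a σ = begin
  length (filterᵇ p (map (a ,_) σ ++ pairs σ))
    ≡⟨ cong length (filter-++ (T? ∘ p) (map (a ,_) σ) (pairs σ)) ⟩
  length (filterᵇ p (map (a ,_) σ) ++ filterᵇ p (pairs σ))
    ≡⟨ length-++ (filterᵇ p (map (a ,_) σ)) ⟩
  length (filterᵇ p (map (a ,_) σ)) N.+ length (filterᵇ p (pairs σ))
    ≡⟨ cong (λ l → length l N.+ length (filterᵇ p (pairs σ))) (filterᵇ-map p (a ,_) σ) ⟩
  length (map (a ,_) (filterᵇ (p ∘ (a ,_)) σ)) N.+ length (filterᵇ p (pairs σ))
    ≡⟨ cong (N._+ length (filterᵇ p (pairs σ))) (length-map (a ,_) (filterᵇ (p ∘ (a ,_)) σ)) ⟩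
  length (filterᵇ (p ∘ (a ,_)) σ) N.+ length (filterᵇ p (pairs σ)) ∎
  where open ≡-Reasoning

inv-∷ : ∀ a σ → inv (a ∷ σ) ≡ length (filterᵇ (_<ᵇ a) σ) N.+ inv σ
inv-∷ a σ = length-filterᵇ-pairs-∷ _ a σ

length-filterᵇ-below : ∀ {a} σ → All (_< a) σ → length (filterᵇ (_<ᵇ a) σ) ≡ length σ
length-filterᵇ-below {a} σ σ<a = cong length (filter-all (T? ∘ (_<ᵇ a)) (All.map <⇒<ᵇ σ<a))

inv-max-∷ : ∀ {a} σ → All (_< a) σ → inv (a ∷ σ) ≡ length σ N.+ inv σ
inv-max-∷ {a} σ σ<a = trans (inv-∷ a σ) (cong (N._+ inv σ) (length-filterᵇ-below σ σ<a))

inv-rise-∷ : ∀ {a b} σ → a < b → All (_< a) σ → inv (a ∷ b ∷ σ) ≡ (length σ N.+ length σ) N.+ inv σ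
inv-rise-∷ {a} {b} σ a<b σ<a = begin
  inv (a ∷ b ∷ σ)                                          ≡⟨ inv-∷ a (b ∷ σ) ⟩
  length (filterᵇ (_<ᵇ a) (b ∷ σ)) N.+ inv (b ∷ σ)
    ≡⟨ cong₂ N._+_ (cong length (filter-reject (T? ∘ (_<ᵇ a)) (<⇒≯ a<b ∘ <ᵇ⇒< b a)))
                   (inv-max-∷ σ (All.map (λ c<a → <-trans c<a a<b) σ<a)) ⟩
  length (filterᵇ (_<ᵇ a) σ) N.+ (length σ N.+ inv σ)      ≡⟨ cong (N._+ _) (length-filterᵇ-below σ σ<a) ⟩
  length σ N.+ (length σ N.+ inv σ)                        ≡⟨ ℕ.+-assoc (length σ) (length σ) (inv σ) ⟨
  (length σ N.+ length σ) N.+ inv σ                        ∎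
  where open ≡-Reasoning

-- The two-term recurrence

module _ {c ℓ : Level} (R : CommutativeSemiring c ℓ) where
  open CommutativeSemiring R renaming (sym to ≈-sym; trans to ≈-trans)

  pow-+ : ∀ a m k → pow R a (m N.+ k) ≈ pow R a m * pow R a k
  pow-+ a zero    k = ≈-sym (*-identityˡ _)
  pow-+ a (suc m) k = ≈-trans (*-congˡ (pow-+ a m k)) (≈-sym (*-assoc _ _ _))

module Weights {c ℓ : Level} (R : CommutativeSemiring c ℓ) (x y q : CommutativeSemiring.Carrier R) where
  open CommutativeSemiring R renaming (refl to ≈-refl; sym to ≈-sym; trans to ≈-trans)
  open import Algebra.Properties.CommutativeSemigroup *-commutativeSemigroup using (interchange; x∙yz≈y∙xz)
  open import Relation.Binary.Reasoning.Setoid setoid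

  weight : List ℕ → Carrier
  weight π = (pow R x (sStat π) * pow R y (dStat π)) * pow R q (inv π)

  -- FI R x y q n is definitionally weightSum (Av n).
  weightSum : List (List ℕ) → Carrier
  weightSum = foldr (λ π acc → weight π + acc) 0#

  weightSum-++ : ∀ πs σs → weightSum (πs ++ σs) ≈ weightSum πs + weightSum σs
  weightSum-++ []       σs = ≈-sym (+-identityˡ _)
  weightSum-++ (π ∷ πs) σs = ≈-trans (+-congˡ (weightSum-++ πs σs)) (≈-sym (+-assoc _ _ _))

  weightSum-map : ∀ (f : List ℕ → List ℕ) a σs → All (λ σ → weight (f σ) ≈ a * weight σ) σs →
    weightSum (map f σs) ≈ a * weightSum σs
  weightSum-map f a []       []       = ≈-sym (zeroʳ a)
  weightSum-map f a (σ ∷ σs) (e ∷ es) = ≈-trans (+-cong e (weightSum-map f a σs es)) (≈-sym (distribˡ a _ _))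

  weight-stats : ∀ π {s d i} → sStat π ≡ s → dStat π ≡ d → inv π ≡ i →
    weight π ≈ (pow R x s * pow R y d) * pow R q i
  weight-stats π refl refl refl = ≈-refl

  weight-max-∷ : ∀ {a} σ → All (_< a) σ → weight (a ∷ σ) ≈ (x * pow R q (length σ)) * weight σ
  weight-max-∷ {a} σ σ<a = begin
    weight (a ∷ σ)
      ≈⟨ weight-stats (a ∷ σ) (cong (length ∘ filterᵇ (_≡ᵇ 1)) runs≡)
                              (cong (length ∘ filterᵇ (_≡ᵇ 2)) runs≡) (inv-max-∷ σ σ<a) ⟩
    ((x * X) * Y) * pow R q (length σ N.+ inv σ)  ≈⟨ *-cong (*-assoc x X Y) (pow-+ R q (length σ) (inv σ)) ⟩
    (x * (X * Y)) * (pow R q (length σ) * Qi)     ≈⟨ interchange x (X * Y) _ Qi ⟩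
    (x * pow R q (length σ)) * weight σ           ∎
    where
    X = pow R x (sStat σ)
    Y = pow R y (dStat σ)
    Qi = pow R q (inv σ)
    runs≡ = runsFrom-max 1 σ σ<a

  weight-rise-∷ : ∀ {a b} σ → a < b → All (_< a) σ →
    weight (a ∷ b ∷ σ) ≈ (y * pow R q (length σ N.+ length σ)) * weight σ
  weight-rise-∷ {a} {b} σ a<b σ<a = begin
    weight (a ∷ b ∷ σ)
      ≈⟨ weight-stats (a ∷ b ∷ σ) (cong (length ∘ filterᵇ (_≡ᵇ 1)) runs≡)
                                  (cong (length ∘ filterᵇ (_≡ᵇ 2)) runs≡) (inv-rise-∷ σ a<b σ<a) ⟩
    (X * (y * Y)) * pow R q (|σ|+|σ| N.+ inv σ)  ≈⟨ *-cong (x∙yz≈y∙xz X y Y) (pow-+ R q |σ|+|σ| (inv σ)) ⟩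
    (y * (X * Y)) * (pow R q |σ|+|σ| * Qi)       ≈⟨ interchange y (X * Y) _ Qi ⟩
    (y * pow R q |σ|+|σ|) * weight σ             ∎
    where
    X = pow R x (sStat σ)
    Y = pow R y (dStat σ)
    Qi = pow R q (inv σ)
    |σ|+|σ| = length σ N.+ length σ
    runs≡ = runs-rise-∷ σ a<b σ<a

  FI-1 : FI R x y q 1 ≈ x
  FI-1 = ≈-trans (+-identityʳ _) (≈-trans (*-identityʳ _) (≈-trans (*-identityʳ _) (*-identityʳ x)))

  FI-recurrence : ∀ n → FI R x y q (suc (suc n))
    ≈ (y * pow R q (n N.+ n)) * FI R x y q n + (x * pow R q (suc n)) * FI R x y q (suc n)
  FI-recurrence n = begin
    FI R x y q (suc (suc n))
      ≡⟨ cong weightSum (Av-suc-suc n) ⟩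
    weightSum (map (λ σ → suc n ∷ suc (suc n) ∷ σ) (Av n) ++ map (suc (suc n) ∷_) (Av (suc n)))
      ≈⟨ weightSum-++ (map _ (Av n)) _ ⟩
    weightSum (map (λ σ → suc n ∷ suc (suc n) ∷ σ) (Av n)) + weightSum (map (suc (suc n) ∷_) (Av (suc n)))
      ≈⟨ +-cong (weightSum-map _ _ (Av n) (All.map rise (Av-Word n)))
                (weightSum-map _ _ (Av (suc n)) (All.map top (Av-Word (suc n)))) ⟩
    (y * pow R q (n N.+ n)) * FI R x y q n + (x * pow R q (suc n)) * FI R x y q (suc n) ∎
    where
    rise : ∀ {σ} → Word n n σ → weight (suc n ∷ suc (suc n) ∷ σ) ≈ (y * pow R q (n N.+ n)) * weight σ
    rise {σ} w@(|σ|≡n , _) = ≈-trans (weight-rise-∷ σ (n<1+n (suc n)) (Word-<-suc w))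
      (reflexive (cong (λ k → (y * pow R q (k N.+ k)) * weight σ) |σ|≡n))
    top : ∀ {σ} → Word (suc n) (suc n) σ → weight (suc (suc n) ∷ σ) ≈ (x * pow R q (suc n)) * weight σ
    top {σ} w@(|σ|≡n+1 , _) = ≈-trans (weight-max-∷ σ (Word-<-suc w))
      (reflexive (cong (λ k → (x * pow R q k) * weight σ) |σ|≡n+1))

-- Unrolling the recurrence

module Exponent where
  open import Data.Nat using (_+_; _*_; _∸_; _/_)

  exponent : ℕ → ℕ → ℕ
  exponent n j = ((n * n + 3 * n + j) ∸ j * j) / 2

  exponent-suc : ∀ n j → j ≤ n → exponent (suc n) j ≡ suc (suc n) + exponent n j
  exponent-suc n j j≤n = begin
    ((suc n * suc n + 3 * suc n + j) ∸ j * j) / 2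
      ≡⟨ cong (λ m → (m ∸ j * j) / 2) (expand n j) ⟩
    (((n * n + 3 * n + j) + suc (suc n) * 2) ∸ j * j) / 2
      ≡⟨ cong (_/ 2) (+-∸-comm (suc (suc n) * 2) j²≤) ⟩
    (((n * n + 3 * n + j) ∸ j * j) + suc (suc n) * 2) / 2
      ≡⟨ +-distrib-/-∣ʳ ((n * n + 3 * n + j) ∸ j * j) (divides (suc (suc n)) refl) ⟩
    exponent n j + suc (suc n) * 2 / 2
      ≡⟨ cong (exponent n j +_) (m*n/n≡m (suc (suc n)) 2) ⟩
    exponent n j + suc (suc n)
      ≡⟨ ℕ.+-comm (exponent n j) _ ⟩
    suc (suc n) + exponent n j ∎
    where
    open ≡-Reasoning
    expand : ∀ n j → suc n * suc n + 3 * suc n + j ≡ (n * n + 3 * n + j) + suc (suc n) * 2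
    expand = solve-∀
    j²≤ : j * j ≤ n * n + 3 * n + j
    j²≤ = ≤-trans (*-mono-≤ j≤n j≤n) (≤-trans (m≤m+n (n * n) (3 * n)) (m≤m+n _ j))

  exponent-diag : ∀ m → exponent m m ≡ m + m
  exponent-diag m = begin
    ((m * m + 3 * m + m) ∸ m * m) / 2   ≡⟨ cong (λ k → (k ∸ m * m) / 2) (regroup m) ⟩
    ((m * m + (m + m) * 2) ∸ m * m) / 2 ≡⟨ cong (_/ 2) (m+n∸m≡n (m * m) _) ⟩
    (m + m) * 2 / 2                     ≡⟨ m*n/n≡m (m + m) 2 ⟩
    m + m                               ∎
    where
    open ≡-Reasoning
    regroup : ∀ m → m * m + 3 * m + m ≡ m * m + (m + m) * 2
    regroup = solve-∀

  suc-C-2 : ∀ m → suc m C 2 ≡ m + m C 2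
  suc-C-2 m = trans (sym (nCk+nC[k+1]≡[n+1]C[k+1] m 1)) (cong (_+ m C 2) (nC1≡n m))

open Exponent

module ClosedForm {c ℓ : Level} (R : CommutativeSemiring c ℓ) (x y q : CommutativeSemiring.Carrier R) where
  open CommutativeSemiring R renaming (refl to ≈-refl; sym to ≈-sym; trans to ≈-trans)
  open import Algebra.Properties.CommutativeSemigroup *-commutativeSemigroup using (interchange)
  open import Algebra.Properties.CommutativeSemigroup +-commutativeSemigroup using (x∙yz≈y∙zx)
  open import Relation.Binary.Reasoning.Setoid setoid

  summand : (ℕ → Carrier) → ℕ → ℕ → Carrier
  summand F n j = ((pow R x (n N.∸ j) * y) * pow R q (exponent n j)) * F j

  sumTo-cong : ∀ n {f g : ℕ → Carrier} → (∀ j → j ≤ n → f j ≈ g j) → sumTo R n f ≈ sumTo R n g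
  sumTo-cong zero    f≈g = f≈g 0 z≤n
  sumTo-cong (suc n) f≈g = +-cong (sumTo-cong n λ j j≤n → f≈g j (m≤n⇒m≤1+n j≤n)) (f≈g (suc n) ≤-refl)

  sumTo-distribˡ : ∀ n a (f : ℕ → Carrier) → a * sumTo R n f ≈ sumTo R n (λ j → a * f j)
  sumTo-distribˡ zero    a f = ≈-refl
  sumTo-distribˡ (suc n) a f = ≈-trans (distribˡ a _ _) (+-congʳ (sumTo-distribˡ n a f))

  leading-step : ∀ m → (x * pow R q m) * (pow R x m * pow R q (m C 2)) ≈ pow R x (suc m) * pow R q (suc m C 2)
  leading-step m = begin
    (x * pow R q m) * (pow R x m * pow R q (m C 2)) ≈⟨ interchange x _ _ _ ⟩
    pow R x (suc m) * (pow R q m * pow R q (m C 2)) ≈⟨ *-congˡ (pow-+ R q m (m C 2)) ⟨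
    pow R x (suc m) * pow R q (m N.+ m C 2)         ≡⟨ cong (λ k → pow R x (suc m) * pow R q k) (suc-C-2 m) ⟨
    pow R x (suc m) * pow R q (suc m C 2)           ∎

  summand-step : ∀ F n j → j ≤ n →
    (x * pow R q (suc (suc n))) * summand F n j ≈ summand F (suc n) j
  summand-step F n j j≤n = begin
    (x * Q) * (((X * y) * pow R q (exponent n j)) * F j)
      ≈⟨ *-assoc _ _ (F j) ⟨
    ((x * Q) * ((X * y) * pow R q (exponent n j))) * F j
      ≈⟨ *-congʳ (interchange x Q (X * y) _) ⟩
    ((x * (X * y)) * (Q * pow R q (exponent n j))) * F j
      ≈⟨ *-congʳ (*-cong (≈-sym (*-assoc x X y)) (≈-sym (pow-+ R q (suc (suc n)) (exponent n j)))) ⟩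
    ((pow R x (suc (n N.∸ j)) * y) * pow R q (suc (suc n) N.+ exponent n j)) * F j
      ≡⟨ cong₂ (λ a b → ((pow R x a * y) * pow R q b) * F j)
           (sym (+-∸-assoc 1 j≤n)) (sym (exponent-suc n j j≤n)) ⟩
    summand F (suc n) j ∎
    where
    Q = pow R q (suc (suc n))
    X = pow R x (n N.∸ j)

  summand-diag : ∀ F m → (y * pow R q (m N.+ m)) * F m ≈ summand F m m
  summand-diag F m = *-congʳ (begin
    y * pow R q (m N.+ m)                       ≈⟨ *-congʳ (*-identityˡ y) ⟨
    (1# * y) * pow R q (m N.+ m)                ≡⟨ cong₂ (λ a b → (pow R x a * y) * pow R q b)
                                                     (sym (n∸n≡0 m)) (sym (exponent-diag m)) ⟩
    (pow R x (m N.∸ m) * y) * pow R q (exponent m m) ∎)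

  recurrence⇒closed-form : (F : ℕ → Carrier) → F 1 ≈ x →
    (∀ n → F (suc (suc n)) ≈ (y * pow R q (n N.+ n)) * F n + (x * pow R q (suc n)) * F (suc n)) →
    ∀ n → F (suc (suc n)) ≈ pow R x (suc (suc n)) * pow R q (suc (suc n) C 2) + sumTo R n (summand F n)
  recurrence⇒closed-form F F1≈x rec zero = begin
    F 2                                                   ≈⟨ rec 0 ⟩
    (y * pow R q 0) * F 0 + (x * pow R q 1) * F 1        ≈⟨ +-comm _ _ ⟩
    (x * pow R q 1) * F 1 + (y * pow R q 0) * F 0
      ≈⟨ +-cong (*-congˡ (≈-trans F1≈x (≈-sym (≈-trans (*-identityʳ _) (*-identityʳ x)))))
                (summand-diag F 0) ⟩
    (x * pow R q 1) * (pow R x 1 * pow R q (1 C 2)) + summand F 0 0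
      ≈⟨ +-congʳ (leading-step 1) ⟩
    pow R x 2 * pow R q (2 C 2) + summand F 0 0          ∎
  recurrence⇒closed-form F F1≈x rec (suc n) = begin
    F (suc (suc (suc n)))
      ≈⟨ rec (suc n) ⟩
    D + (x * Q) * F (suc (suc n))
      ≈⟨ +-congˡ (*-congˡ (recurrence⇒closed-form F F1≈x rec n)) ⟩
    D + (x * Q) * (L + sumTo R n (summand F n))
      ≈⟨ +-congˡ (≈-trans (distribˡ _ _ _) (+-congˡ (sumTo-distribˡ n _ (summand F n)))) ⟩
    D + ((x * Q) * L + sumTo R n (λ j → (x * Q) * summand F n j))
      ≈⟨ +-congˡ (+-cong (leading-step (suc (suc n))) (sumTo-cong n (summand-step F n))) ⟩
    D + (L′ + sumTo R n (summand F (suc n)))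
      ≈⟨ x∙yz≈y∙zx D L′ _ ⟩
    L′ + (sumTo R n (summand F (suc n)) + D)
      ≈⟨ +-congˡ (+-congˡ (summand-diag F (suc n))) ⟩
    L′ + sumTo R (suc n) (summand F (suc n)) ∎
    where
    D = (y * pow R q (suc n N.+ suc n)) * F (suc n)
    Q = pow R q (suc (suc n))
    L = pow R x (suc (suc n)) * pow R q (suc (suc n) C 2)
    L′ = pow R x (suc (suc (suc n))) * pow R q (suc (suc (suc n)) C 2)

theorem4p4 : {c ℓ : Level} (R : CommutativeSemiring c ℓ)
    (x y q : CommutativeSemiring.Carrier R) (n : ℕ) →
    let open CommutativeSemiring R in
    FI R x y q (n N.+ 2)
      ≈ (pow R x (n N.+ 2) * pow R q ((n N.+ 2) C 2))
        + sumTo R n (λ j → ((pow R x (n N.∸ j) * y)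
              * pow R q (((n N.* n N.+ 3 N.* n N.+ j) N.∸ j N.* j) N./ 2)) * FI R x y q j)
theorem4p4 R x y q n rewrite ℕ.+-comm n 2 =
  recurrence⇒closed-form (FI R x y q) FI-1 FI-recurrence n
  where
  open ClosedForm R x y q
  open Weights R x y q
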